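{- Let $G$ be an $SQSR(n, k, 0; k-1, k-2, k-3)$ graph with $k = 4$. Then $n \leq k^2 - 4 = 12$.
   Context: All graphs are finite and simple. A $QSR(n,k,a;c_1,\ldots,c_p)$ graph is a $k$-regular graph on $n$ vertices such that any two adjacent vertices have exactly $a$ common neighbours and any two distinct non-adjacent vertices have exactly $c_i$ common neighbours for some $1 \le i \le p$. Its grade is the number of indices $i$ for which there actually exist two non-adjacent vertices with exactly $c_i$ common neighbours; it is proper if its grade is $p$. An $SQSR(n,k,a;c_1,\ldots,c_p)$ graph is a proper $QSR(n,k,a;c_1,\ldots,c_p)$ graph in which $a, c_1, \ldots, c_p$ are pairwise distinct. -}

module Defs where

open import Data.Nat using (ℕ; _∸_)
open import Data.Bool using (Bool; true; false; _∧_)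
open import Data.Fin using (Fin)
open import Data.List using (List; _∷_; []; filter; length; allFin)
open import Data.List.Membership.Propositional using (_∈_)
open import Data.List.Relation.Unary.All using (All)
open import Data.List.Relation.Unary.Unique.Propositional using (Unique)
open import Data.Product using (Σ; _×_; ∃)
open import Relation.Nullary using (¬_)
open import Relation.Binary.PropositionalEquality using (_≡_)
open import Data.Bool.Properties using (T?)

record Graph (n : ℕ) : Set where
  field
    adj    : Fin n → Fin n → Bool
    sym    : ∀ u v → adj u v ≡ adj v u
    irrefl : ∀ v → adj v v ≡ false

open Graph public

count : ∀ {n} → (Fin n → Bool) → ℕ
count {n} p = length (filter (λ w → T? (p w)) (allFin n))

degree : ∀ {n} → Graph n → Fin n → ℕ
degree G v = count (adj G v)

common : ∀ {n} → Graph n → Fin n → Fin n → ℕ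
common G u v = count (λ w → adj G u w ∧ adj G v w)

IsQSR : (n k a : ℕ) → List ℕ → Graph n → Set
IsQSR n k a cs G =
  (∀ v → degree G v ≡ k) ×
  (∀ u v → adj G u v ≡ true → common G u v ≡ a) ×
  (∀ u v → ¬ (u ≡ v) → adj G u v ≡ false → common G u v ∈ cs)

IsProper : ∀ {n} → List ℕ → Graph n → Set
IsProper cs G =
  All (λ c → Σ _ λ u → Σ _ λ v →
         ¬ (u ≡ v) × adj G u v ≡ false × common G u v ≡ c) cs

IsSQSR : (n k a : ℕ) → List ℕ → Graph n → Set
IsSQSR n k a cs G = IsQSR n k a cs G × IsProper cs G × Unique (a ∷ cs)

-- Let u, w be non-adjacent with three common neighbours, the centres. Since G is triangle-free
-- and any two non-adjacent vertices have a common neighbour, N(u) and N(w) consist of the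
-- centres together with one more vertex each, x and y, and x ~ y; moreover every vertex is one
-- of u, w, x, y, a centre, or one of the two further neighbours of a centre (its outer vertices).
-- So n ≤ 13, and if n = 13 these thirteen vertices are distinct.  Then every outer vertex r is
-- adjacent to x or y: otherwise its three neighbours besides its centre lie on the two other
-- centres, so r sees both outer vertices of one of them, q, and a vertex γ on the last one, and
-- the common neighbour of γ and q closes a triangle.  But x and y have only four free edges for
-- the six outer vertices.

module Submission where

open import Defs hiding (sym)
open import Data.Nat using (ℕ; zero; suc; _+_; _*_; _∸_; _≤_; _<_; _≤?_)
open import Data.Nat.Properties using (<⇒≤; ≤-refl; ≤-trans; ≰⇒>; 1+n≰n; n<1+n)
open import Data.Bool as Bool using (Bool; true; false; _∧_)
open import Data.Bool.Properties using (T?; T-≡; ¬-not; not-¬)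
open import Data.Fin using (Fin; zero; suc; #_; _↑ˡ_; _↑ʳ_; punchIn; punchOut; splitAt; remQuot; combine)
open import Data.Fin.Properties using (_≟_; any?; ¬∀⟶∃¬; injective⇒≤; pigeonhole; punchOut-injective; <⇒≢; punchIn-punchOut; ↑ˡ-injective; splitAt-↑ˡ; splitAt-↑ʳ; splitAt⁻¹-↑ˡ; splitAt⁻¹-↑ʳ; remQuot-combine; ↑ʳ-injective; combine-injectiveˡ)
open import Data.List using (List; _∷_; []; filter; allFin; lookup)
open import Data.List.Membership.Propositional using (_∈_)
open import Data.List.Membership.Propositional.Properties using (∈-lookup; ∈-filter⁺; ∈-filter⁻; ∈-allFin)
open import Data.List.Relation.Unary.Any using (index; there)
open import Data.List.Relation.Unary.Any.Properties using (lookup-index)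
open import Data.List.Relation.Unary.All as All using (_∷_)
open import Data.List.Relation.Unary.AllPairs using (_∷_)
open import Data.List.Relation.Unary.Unique.Propositional using (Unique)
open import Data.List.Relation.Unary.Unique.Propositional.Properties using (filter⁺; allFin⁺)
open import Data.Vec.Functional using (Vector; _++_) renaming ([] to []ᵛ; _∷_ to _∷ᵛ_)
open import Data.Product using (Σ; ∃; _×_; _,_; proj₁; proj₂; uncurry)
open import Data.Empty using (⊥; ⊥-elim)
open import Data.Sum as Sum using (_⊎_; inj₁; inj₂; [_,_]′)
open import Data.Vec.Functional.Properties using (lookup-++ˡ; lookup-++ʳ)
open import Function using (_∘_; Equivalence)
open import Function.Definitions using (Injective)
open import Relation.Nullary using (¬_; Dec; yes; no)
open import Relation.Nullary.Decidable using (decidable-stable; from-no)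
open import Relation.Binary.Definitions using (DecidableEquality)
open import Relation.Binary.PropositionalEquality using (_≡_; _≢_; refl; sym; trans; cong; subst)

private
  variable
    A : Set
    k l m : ℕ

Distinct : Vector A m → Set
Distinct = Injective _≡_ _≡_

distinct-in-image⇒≤ : {f : Vector A m} (g : Vector A k) → Distinct f →
                      (∀ i → ∃ λ j → g j ≡ f i) → m ≤ k
distinct-in-image⇒≤ {f = f} g f-inj inImage =
  injective⇒≤ {f = proj₁ ∘ inImage} λ {i} {i′} eq →
    f-inj (trans (sym (proj₂ (inImage i))) (trans (cong g eq) (proj₂ (inImage i′))))

repetition-in-image⇒≤ : {f : Vector A m} (g : Vector A (suc k)) {i j : Fin (suc k)} →
                        i ≢ j → g i ≡ g j → Distinct f →
                        (∀ a → ∃ λ b → g b ≡ f a) → m ≤ k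
repetition-in-image⇒≤ {f = f} g {i} {j} i≢j gi≡gj f-inj inImage =
  distinct-in-image⇒≤ (g ∘ punchIn j) f-inj avoid-j
  where
  avoid-j : ∀ a → ∃ λ b → g (punchIn j b) ≡ f a
  avoid-j a with inImage a
  ... | b , gb≡fa with b ≟ j
  ...   | yes refl = punchOut (i≢j ∘ sym) , trans (cong g (punchIn-punchOut (i≢j ∘ sym))) (trans gi≡gj gb≡fa)
  ...   | no b≢j   = punchOut (b≢j ∘ sym) , trans (cong g (punchIn-punchOut (b≢j ∘ sym))) gb≡fa

↑ˡ≢↑ʳ : ∀ {i : Fin m} {j : Fin k} → i ↑ˡ k ≢ m ↑ʳ j
↑ˡ≢↑ʳ {m = m} {k = k} {i} {j} eq with trans (sym (splitAt-↑ˡ m i k)) (trans (cong (splitAt m) eq) (splitAt-↑ʳ m k j))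
... | ()

Fin2-cover : ∀ {a b : Fin 2} → a ≢ b → ∀ j → j ≡ a ⊎ j ≡ b
Fin2-cover {zero}     {zero}     a≢b _          = ⊥-elim (a≢b refl)
Fin2-cover {zero}     {suc zero} _   zero       = inj₁ refl
Fin2-cover {zero}     {suc zero} _   (suc zero) = inj₂ refl
Fin2-cover {suc zero} {zero}     _   zero       = inj₂ refl
Fin2-cover {suc zero} {zero}     _   (suc zero) = inj₁ refl
Fin2-cover {suc zero} {suc zero} a≢b _          = ⊥-elim (a≢b refl)

singleton-distinct : {t : A} → Distinct (t ∷ᵛ []ᵛ)
singleton-distinct {x = zero} {zero} _ = refl

∷-distinct : {g : Vector A m} {t : A} → Distinct g → (∀ i → g i ≢ t) → Distinct (t ∷ᵛ g)
∷-distinct g-inj t∉g {zero}  {zero}  _  = refl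
∷-distinct g-inj t∉g {zero}  {suc j} eq = ⊥-elim (t∉g j (sym eq))
∷-distinct g-inj t∉g {suc i} {zero}  eq = ⊥-elim (t∉g i eq)
∷-distinct g-inj t∉g {suc i} {suc j} eq = cong suc (g-inj eq)

record Enumeration (P : A → Set) (k : ℕ) : Set where
  field
    elem          : Vector A k
    elem-distinct : Distinct elem
    elem-valid    : ∀ i → P (elem i)
    elem-complete : ∀ {t} → P t → ∃ λ i → elem i ≡ t

enumeration-resp : {P Q : A → Set} → (∀ {t} → P t → Q t) → (∀ {t} → Q t → P t) →
                   Enumeration P k → Enumeration Q k
enumeration-resp P⇒Q Q⇒P e = record
  { elem = elem ; elem-distinct = elem-distinct
  ; elem-valid = P⇒Q ∘ elem-valid ; elem-complete = elem-complete ∘ Q⇒P }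
  where open Enumeration e

module _ {P : A → Set} where

  distinct⇒≤-size : Enumeration P k → (g : Vector A m) → Distinct g → (∀ i → P (g i)) → m ≤ k
  distinct⇒≤-size e g g-inj g-valid = distinct-in-image⇒≤ elem g-inj (elem-complete ∘ g-valid)
    where open Enumeration e

  module _ (_≟ᴬ_ : DecidableEquality A) (e : Enumeration P k) where
    open Enumeration e

    fresh-element : (g : Vector A m) → Distinct g → m < k → ∃ λ t → P t × (∀ i → g i ≢ t)
    fresh-element g g-inj m<k with ¬∀⟶∃¬ _ _ (λ j → any? (λ i → g i ≟ᴬ elem j)) all-hit
      where
      all-hit : ¬ (∀ j → ∃ λ i → g i ≡ elem j)
      all-hit hit = 1+n≰n (≤-trans m<k (distinct-in-image⇒≤ g elem-distinct hit))
    ... | j , j∉g = elem j , elem-valid j , λ i gi≡ej → j∉g (i , gi≡ej)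

    distinct-of-size⇒enumeration : (g : Vector A k) → Distinct g → (∀ i → P (g i)) → Enumeration P k
    distinct-of-size⇒enumeration g g-inj g-valid = record
      { elem = g ; elem-distinct = g-inj ; elem-valid = g-valid ; elem-complete = complete }
      where
      complete : ∀ {t} → P t → ∃ λ i → g i ≡ t
      complete {t} Pt = decidable-stable (any? (λ i → g i ≟ᴬ t)) λ t∉g →
        1+n≰n (distinct⇒≤-size e (t ∷ᵛ g) (∷-distinct g-inj (λ i eq → t∉g (i , eq)))
                                λ { zero → Pt ; (suc i) → g-valid i })

  record Extension (g : Vector A m) (l : ℕ) : Set where
    field
      new          : Vector A l
      new-distinct : Distinct new
      new-valid    : ∀ a → P (new a)
      new-fresh    : ∀ a i → new a ≢ g i
      classify     : ∀ {t} → P t → (∃ λ a → new a ≡ t) ⊎ (∃ λ i → g i ≡ t)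

  -- Opaque, so that the type checker never unfolds the search for the new elements.
  opaque
    extend : (_≟ᴬ_ : DecidableEquality A) → ∀ l → Enumeration P (l + m) →
             (g : Vector A m) → Distinct g → (∀ i → P (g i)) → Extension g l
    extend {m = m} _≟ᴬ_ l e g g-inj g-valid with grow l ≤-refl
      where
      grow : ∀ j → j + m ≤ l + m →
             Σ (Vector A (j + m)) λ f → Distinct f × (∀ i → P (f i)) × (∀ i → f (j ↑ʳ i) ≡ g i)
      grow zero    _      = g , g-inj , g-valid , λ _ → refl
      grow (suc j) j+m<k with grow j (<⇒≤ j+m<k)
      ... | f , f-inj , f-valid , f-ext with fresh-element _≟ᴬ_ e f f-inj j+m<k
      ... | t , Pt , t∉f = t ∷ᵛ f , ∷-distinct f-inj t∉f , (λ { zero → Pt ; (suc i) → f-valid i }) , f-ext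
    ... | f , f-inj , f-valid , f-ext = record
      { new          = f ∘ (_↑ˡ m)
      ; new-distinct = ↑ˡ-injective m _ _ ∘ f-inj
      ; new-valid    = f-valid ∘ (_↑ˡ m)
      ; new-fresh    = λ a i eq → ↑ˡ≢↑ʳ (f-inj (trans eq (sym (f-ext i))))
      ; classify     = classify
      }
      where
      open Enumeration (distinct-of-size⇒enumeration _≟ᴬ_ e f f-inj f-valid)
      classify : ∀ {t} → P t → (∃ λ a → f (a ↑ˡ m) ≡ t) ⊎ (∃ λ i → g i ≡ t)
      classify Pt with elem-complete Pt
      ... | b , fb≡t with splitAt l b in split
      ...   | inj₁ a = inj₁ (a , trans (cong f (splitAt⁻¹-↑ˡ split)) fb≡t)
      ...   | inj₂ i = inj₂ (i , trans (sym (f-ext i)) (trans (cong f (splitAt⁻¹-↑ʳ split)) fb≡t))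

lookup-distinct : {xs : List A} → Unique xs → Distinct (lookup xs)
lookup-distinct {xs = _ ∷ _} _               {zero}  {zero}  _  = refl
lookup-distinct {xs = _ ∷ _} (x∉ ∷ _)        {zero}  {suc j} eq = ⊥-elim (All.lookup x∉ (∈-lookup j) eq)
lookup-distinct {xs = _ ∷ _} (x∉ ∷ _)        {suc i} {zero}  eq = ⊥-elim (All.lookup x∉ (∈-lookup i) (sym eq))
lookup-distinct {xs = _ ∷ _} (_ ∷ xs-unique) {suc i} {suc j} eq = cong suc (lookup-distinct xs-unique eq)

count-enumeration : ∀ {n} (p : Fin n → Bool) → Enumeration (λ t → p t ≡ true) (count p)
count-enumeration {n} p = record
  { elem          = lookup chosen
  ; elem-distinct = lookup-distinct (filter⁺ (T? ∘ p) (allFin⁺ n))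
  ; elem-valid    = λ i → Equivalence.to T-≡ (proj₂ (∈-filter⁻ (T? ∘ p) {xs = allFin n} (∈-lookup i)))
  ; elem-complete = λ pt → let t∈ = ∈-filter⁺ (T? ∘ p) (∈-allFin _) (Equivalence.from T-≡ pt)
                           in index t∈ , sym (lookup-index t∈)
  }
  where
  chosen : List (Fin n)
  chosen = filter (T? ∘ p) (allFin n)

∧-true⁻ : ∀ {a b} → a ∧ b ≡ true → a ≡ true × b ≡ true
∧-true⁻ {true} {true} _ = refl , refl

∧-true⁺ : ∀ {a b} → a ≡ true × b ≡ true → a ∧ b ≡ true
∧-true⁺ (refl , refl) = refl

module _ {n : ℕ} (G : Graph n) where

  infix 4 _~_ _~?_
  _~_ : Fin n → Fin n → Set
  p ~ q = adj G p q ≡ true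

  _~?_ : ∀ p q → Dec (p ~ q)
  p ~? q = adj G p q Bool.≟ true

  ~-sym : ∀ {p q} → p ~ q → q ~ p
  ~-sym {p} {q} = trans (Graph.sym G q p)

  TriangleFree : Set
  TriangleFree = ∀ {p q r} → p ~ q → p ~ r → q ~ r → ⊥

  Diameter≤2 : Set
  Diameter≤2 = ∀ {p q} → p ≢ q → ¬ p ~ q → ∃ λ r → p ~ r × q ~ r

  neighbourhood : ∀ {v k} → degree G v ≡ k → Enumeration (v ~_) k
  neighbourhood refl = count-enumeration (adj G _)

  common-neighbourhood : ∀ {p q k} → common G p q ≡ k → Enumeration (λ t → p ~ t × q ~ t) k
  common-neighbourhood refl = enumeration-resp ∧-true⁻ ∧-true⁺ (count-enumeration _)

  no-common-neighbour⇒triangle-free : (∀ p q → p ~ q → common G p q ≡ 0) → TriangleFree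
  no-common-neighbour⇒triangle-free a≡0 p~q p~r q~r
    with () ← proj₁ (Enumeration.elem-complete (common-neighbourhood (a≡0 _ _ p~q)) (p~r , q~r))

  positive-common-neighbours⇒diameter≤2 : ∀ {cs} → ¬ 0 ∈ cs →
    (∀ p q → p ≢ q → adj G p q ≡ false → common G p q ∈ cs) → Diameter≤2
  positive-common-neighbours⇒diameter≤2 0∉cs c∈cs {p} {q} p≢q p≁q
    with common G p q in c | c∈cs p q p≢q (¬-not p≁q)
  ... | zero  | 0∈cs = ⊥-elim (0∉cs 0∈cs)
  ... | suc _ | _    = elem zero , elem-valid zero
    where open Enumeration (common-neighbourhood c)

  module Configuration
    (degree≡4 : ∀ v → degree G v ≡ 4) (triangle-free : TriangleFree) (diameter≤2 : Diameter≤2)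
    {u w : Fin n} (u≢w : u ≢ w) (u≁w : ¬ u ~ w) (common≡3 : common G u w ≡ 3)
    where

    open Enumeration

    N : ∀ v → Enumeration (v ~_) 4
    N v = neighbourhood (degree≡4 v)

    centres : Enumeration (λ t → u ~ t × w ~ t) 3
    centres = common-neighbourhood common≡3

    centre : Fin 3 → Fin n
    centre = elem centres

    u~centre : ∀ i → u ~ centre i
    u~centre = proj₁ ∘ elem-valid centres

    w~centre : ∀ i → w ~ centre i
    w~centre = proj₂ ∘ elem-valid centres

    private
      module U = Extension (extend _≟_ 1 (N u) centre (elem-distinct centres) u~centre)
      module W = Extension (extend _≟_ 1 (N w) centre (elem-distinct centres) w~centre)

    x y : Fin n
    x = U.new zero
    y = W.new zero

    u-neighbour : ∀ {t} → u ~ t → x ≡ t ⊎ ∃ λ i → centre i ≡ t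
    u-neighbour u~t with U.classify u~t
    ... | inj₁ (zero , x≡t) = inj₁ x≡t
    ... | inj₂ on-centre    = inj₂ on-centre

    w-neighbour : ∀ {t} → w ~ t → y ≡ t ⊎ ∃ λ i → centre i ≡ t
    w-neighbour w~t with W.classify w~t
    ... | inj₁ (zero , y≡t) = inj₁ y≡t
    ... | inj₂ on-centre    = inj₂ on-centre

    u~x : u ~ x
    u~x = U.new-valid zero

    w~y : w ~ y
    w~y = W.new-valid zero

    x~y : x ~ y
    x~y with diameter≤2 u≢y u≁y
      where
      u≢y : u ≢ y
      u≢y u≡y = u≁w (~-sym (subst (w ~_) (sym u≡y) w~y))
      u≁y : ¬ u ~ y
      u≁y u~y with elem-complete centres (u~y , w~y)
      ... | i , centre≡y = W.new-fresh zero i (sym centre≡y)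
    ... | t , u~t , y~t with u-neighbour u~t
    ...   | inj₁ refl       = ~-sym y~t
    ...   | inj₂ (i , refl) = ⊥-elim (triangle-free (w~centre i) w~y (~-sym y~t))

    private
      uw-distinct : Distinct (u ∷ᵛ w ∷ᵛ []ᵛ)
      uw-distinct = ∷-distinct singleton-distinct λ { zero w≡u → u≢w (sym w≡u) }

      centre~uw : ∀ i a → centre i ~ (u ∷ᵛ w ∷ᵛ []ᵛ) a
      centre~uw i zero       = ~-sym (u~centre i)
      centre~uw i (suc zero) = ~-sym (w~centre i)

      module Outer (i : Fin 3) = Extension (extend _≟_ 2 (N (centre i)) (u ∷ᵛ w ∷ᵛ []ᵛ) uw-distinct (centre~uw i))

    outer : Fin 3 → Fin 2 → Fin n
    outer = Outer.new

    centre~outer : ∀ i j → centre i ~ outer i j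
    centre~outer = Outer.new-valid

    centre-neighbour : ∀ {i t} → centre i ~ t → t ≢ u → t ≢ w → ∃ λ j → outer i j ≡ t
    centre-neighbour {i} ci~t t≢u t≢w with Outer.classify i ci~t
    ... | inj₁ on-outer          = on-outer
    ... | inj₂ (zero , u≡t)      = ⊥-elim (t≢u (sym u≡t))
    ... | inj₂ (suc zero , w≡t)  = ⊥-elim (t≢w (sym w≡t))

    adjacent-to-centre : ∀ {t} → t ≢ u → t ≢ w → ¬ u ~ t → ¬ w ~ t → ∃ λ i → centre i ~ t
    adjacent-to-centre t≢u t≢w u≁t w≁t with diameter≤2 (t≢u ∘ sym) u≁t
    ... | s , u~s , t~s with u-neighbour u~s
    ...   | inj₂ (i , refl) = i , ~-sym t~s
    ...   | inj₁ refl with diameter≤2 (t≢w ∘ sym) w≁t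
    ...     | s′ , w~s′ , t~s′ with w-neighbour w~s′
    ...       | inj₂ (i , refl) = i , ~-sym t~s′
    ...       | inj₁ refl       = ⊥-elim (triangle-free x~y (~-sym t~s) (~-sym t~s′))

    root : Vector (Fin n) 4
    root = u ∷ᵛ w ∷ᵛ x ∷ᵛ y ∷ᵛ []ᵛ

    outers : Vector (Fin n) (3 * 2)
    outers = uncurry outer ∘ remQuot 2

    label : Vector (Fin n) (3 + (4 + 3 * 2))
    label = centre ++ (root ++ outers)

    Labelled : Fin n → Set
    Labelled t = ∃ λ k → label k ≡ t

    centre-labelled : ∀ i → Labelled (centre i)
    centre-labelled i = i ↑ˡ _ , lookup-++ˡ centre (root ++ outers) i

    root-labelled : ∀ l → Labelled (root l)
    root-labelled l = 3 ↑ʳ (l ↑ˡ _) ,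
      trans (lookup-++ʳ centre (root ++ outers) (l ↑ˡ _)) (lookup-++ˡ root outers l)

    outer-labelled : ∀ i j → Labelled (outer i j)
    outer-labelled i j = 3 ↑ʳ (4 ↑ʳ combine i j) ,
      trans (lookup-++ʳ centre (root ++ outers) (4 ↑ʳ combine i j))
        (trans (lookup-++ʳ root outers (combine i j)) (cong (uncurry outer) (remQuot-combine i j)))

    labelled : ∀ t → Labelled t
    labelled t with t ≟ u | t ≟ w
    ... | yes refl | _        = root-labelled (# 0)
    ... | no _     | yes refl = root-labelled (# 1)
    ... | no t≢u   | no t≢w with u ~? t | w ~? t
    ...   | yes u~t | _       = [ (λ { refl → root-labelled (# 2) }) , (λ { (i , refl) → centre-labelled i }) ]′
                                    (u-neighbour u~t)
    ...   | no _    | yes w~t = [ (λ { refl → root-labelled (# 3) }) , (λ { (i , refl) → centre-labelled i }) ]′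
                                    (w-neighbour w~t)
    ...   | no u≁t  | no w≁t with adjacent-to-centre t≢u t≢w u≁t w≁t
    ...     | i , ci~t with centre-neighbour ci~t t≢u t≢w
    ...       | j , refl = outer-labelled i j

    module _ (13≤n : 13 ≤ n) where

      label-distinct : Distinct label
      label-distinct {a} {b} la≡lb with a ≟ b
      ... | yes a≡b = a≡b
      ... | no a≢b  = ⊥-elim (1+n≰n (≤-trans 13≤n (repetition-in-image⇒≤ label a≢b la≡lb (λ eq → eq) labelled)))

      common-neighbour-of-centres : ∀ {i i′ t} → centre i ~ t → centre i′ ~ t → t ≢ u → t ≢ w → i ≡ i′
      common-neighbour-of-centres {i} {i′} ci~t ci′~t t≢u t≢w
        with centre-neighbour ci~t t≢u t≢w | centre-neighbour ci′~t t≢u t≢w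
      ... | j , refl | j′ , oij≡t =
        combine-injectiveˡ i j i′ j′ (↑ʳ-injective 4 _ _ (↑ʳ-injective 3 _ _
          (label-distinct (trans (proj₂ (outer-labelled i j)) (trans (sym oij≡t) (sym (proj₂ (outer-labelled i′ j′))))))))

      sees-outer-pair⇒no-foreign-neighbour : ∀ {q s r γ} → (∀ j → r ~ outer q j) → r ~ γ →
                                            centre s ~ γ → s ≢ q → γ ≢ u → γ ≢ w → ⊥
      sees-outer-pair⇒no-foreign-neighbour {q} {s} {r} {γ} r~outer r~γ cs~γ s≢q γ≢u γ≢w
        with diameter≤2 cq≢γ cq≁γ
        where
        cq≢γ : centre q ≢ γ
        cq≢γ cq≡γ = triangle-free (u~centre s) (u~centre q) (subst (centre s ~_) (sym cq≡γ) cs~γ)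
        cq≁γ : ¬ centre q ~ γ
        cq≁γ cq~γ = s≢q (common-neighbour-of-centres cs~γ cq~γ γ≢u γ≢w)
      ... | t , cq~t , γ~t with centre-neighbour cq~t t≢u t≢w
        where
        t≢u : t ≢ u
        t≢u refl = triangle-free (u~centre s) (~-sym γ~t) cs~γ
        t≢w : t ≢ w
        t≢w refl = triangle-free (w~centre s) (~-sym γ~t) cs~γ
      ... | j , refl = triangle-free (r~outer j) r~γ (~-sym γ~t)

      module _ {i r} (ci~r : centre i ~ r) (r≁x : ¬ r ~ x) (r≁y : ¬ r ~ y) where

        private
          r≁u : ¬ r ~ u
          r≁u r~u = triangle-free (u~centre i) (~-sym r~u) ci~r

          r≁w : ¬ r ~ w
          r≁w r~w = triangle-free (w~centre i) (~-sym r~w) ci~r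

          r≢u : r ≢ u
          r≢u r≡u = r≁x (subst (_~ x) (sym r≡u) u~x)

          r≢w : r ≢ w
          r≢w r≡w = r≁y (subst (_~ y) (sym r≡w) w~y)

          neighbour≢ : ∀ {m t} → r ~ m → ¬ r ~ t → m ≢ t
          neighbour≢ r~m r≁t m≡t = r≁t (subst (r ~_) m≡t r~m)

          not-a-centre : ∀ {m} → r ~ m → centre i ≢ m → ∀ k → centre k ≢ m
          not-a-centre r~m ci≢m k refl =
            ci≢m (cong centre (common-neighbour-of-centres ci~r (~-sym r~m) r≢u r≢w))

        other-centre : ∀ {m} → r ~ m → centre i ≢ m → ∃ λ k → k ≢ i × centre k ~ m
        other-centre {m} r~m ci≢m with u ~? m | w ~? m
        ... | yes u~m | _ = ⊥-elim ([ neighbour≢ r~m r≁x ∘ sym , uncurry (not-a-centre r~m ci≢m) ]′ (u-neighbour u~m))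
        ... | no _ | yes w~m = ⊥-elim ([ neighbour≢ r~m r≁y ∘ sym , uncurry (not-a-centre r~m ci≢m) ]′ (w-neighbour w~m))
        ... | no u≁m | no w≁m
          with adjacent-to-centre (neighbour≢ r~m r≁u) (neighbour≢ r~m r≁w) u≁m w≁m
        ...   | k , ck~m with k ≟ i
        ...     | yes refl = ⊥-elim (triangle-free ci~r ck~m r~m)
        ...     | no k≢i   = k , k≢i , ck~m

        private
          r~centre : ∀ a → r ~ (centre i ∷ᵛ []ᵛ) a
          r~centre zero = ~-sym ci~r

          module R = Extension (extend _≟_ 3 (N r) (centre i ∷ᵛ []ᵛ) singleton-distinct r~centre)

          on-other-centre : ∀ a → ∃ λ k → k ≢ i × centre k ~ R.new a
          on-other-centre a = other-centre (R.new-valid a) (λ ci≡m → R.new-fresh a zero (sym ci≡m))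

          centre-of : Fin 3 → Fin 3
          centre-of = proj₁ ∘ on-other-centre

          centre-of≢i : ∀ a → centre-of a ≢ i
          centre-of≢i = proj₁ ∘ proj₂ ∘ on-other-centre

          centre-of~ : ∀ a → centre (centre-of a) ~ R.new a
          centre-of~ = proj₂ ∘ proj₂ ∘ on-other-centre

          on-outer : ∀ a → ∃ λ j → outer (centre-of a) j ≡ R.new a
          on-outer a = centre-neighbour (centre-of~ a)
                         (neighbour≢ (R.new-valid a) r≁u) (neighbour≢ (R.new-valid a) r≁w)

        -- Pigeonhole: two of the three further neighbours of r, a and b, lie on one centre q, so r
        -- sees both outer vertices of q; not all three lie on q, so some c lies on another centre.
        far-from-x-and-y : ⊥
        far-from-x-and-y with pigeonhole (n<1+n 2) (λ a → punchOut (centre-of≢i a ∘ sym))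
        ... | a , b , a<b , same =
          sees-outer-pair⇒no-foreign-neighbour r~outer (R.new-valid c) (centre-of~ c) (proj₂ c-off)
            (neighbour≢ (R.new-valid c) r≁u) (neighbour≢ (R.new-valid c) r≁w)
          where
          q : Fin 3
          q = centre-of a

          on-q : ∀ c → centre-of c ≡ q → ∃ λ j → outer q j ≡ R.new c
          on-q c c-on-q = subst (λ k → ∃ λ j → outer k j ≡ R.new c) c-on-q (on-outer c)

          b-on-q : centre-of b ≡ q
          b-on-q = sym (punchOut-injective (centre-of≢i a ∘ sym) (centre-of≢i b ∘ sym) same)

          ja jb : Fin 2
          ja = proj₁ (on-q a refl)
          jb = proj₁ (on-q b b-on-q)

          ja≢jb : ja ≢ jb
          ja≢jb ja≡jb = <⇒≢ a<b (R.new-distinct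
            (trans (sym (proj₂ (on-q a refl))) (trans (cong (outer q) ja≡jb) (proj₂ (on-q b b-on-q)))))

          r~outer : ∀ j → r ~ outer q j
          r~outer j with Fin2-cover ja≢jb j
          ... | inj₁ refl = subst (r ~_) (sym (proj₂ (on-q a refl))) (R.new-valid a)
          ... | inj₂ refl = subst (r ~_) (sym (proj₂ (on-q b b-on-q))) (R.new-valid b)

          c-off : ∃ λ c → centre-of c ≢ q
          c-off = ¬∀⟶∃¬ 3 _ (λ c → centre-of c ≟ q) λ all-on-q →
            1+n≰n (distinct-in-image⇒≤ (outer q) R.new-distinct (λ c → on-q c (all-on-q c)))

          c : Fin 3
          c = proj₁ c-off

      centre-neighbour~x⊎y : ∀ {i r} → centre i ~ r → r ~ x ⊎ r ~ y
      centre-neighbour~x⊎y {r = r} ci~r with r ~? x | r ~? y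
      ... | yes r~x | _       = inj₁ r~x
      ... | no _    | yes r~y = inj₂ r~y
      ... | no r≁x  | no r≁y  = ⊥-elim (far-from-x-and-y ci~r r≁x r≁y)

      too-many-vertices : ⊥
      too-many-vertices = from-no (10 ≤? 8)
        (distinct-in-image⇒≤ (elem (N x) ++ elem (N y)) (↑ʳ-injective 3 _ _ ∘ label-distinct) in-N-x-or-y)
        where
        near : ∀ {t} → t ~ x ⊎ t ~ y → ∃ λ a → (elem (N x) ++ elem (N y)) a ≡ t
        near (inj₁ t~x) with elem-complete (N x) (~-sym t~x)
        ... | a , eq = a ↑ˡ 4 , trans (lookup-++ˡ (elem (N x)) (elem (N y)) a) eq
        near (inj₂ t~y) with elem-complete (N y) (~-sym t~y)
        ... | a , eq = 4 ↑ʳ a , trans (lookup-++ʳ (elem (N x)) (elem (N y)) a) eq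

        in-N-x-or-y : ∀ k → ∃ λ a → (elem (N x) ++ elem (N y)) a ≡ (root ++ outers) k
        in-N-x-or-y k with splitAt 4 k
        ... | inj₁ zero                   = near (inj₁ u~x)
        ... | inj₁ (suc zero)             = near (inj₂ w~y)
        ... | inj₁ (suc (suc zero))       = near (inj₂ x~y)
        ... | inj₁ (suc (suc (suc zero))) = near (inj₁ (~-sym x~y))
        ... | inj₂ _                      = near (centre-neighbour~x⊎y (centre~outer _ _))

    n≤12 : n ≤ 12
    n≤12 with n ≤? 12
    ... | yes n≤12 = n≤12
    ... | no n≰12  = ⊥-elim (too-many-vertices (≰⇒> n≰12))

mainTheorem6 : (n k : ℕ) (G : Graph n) → k ≡ 4 →
    IsSQSR n k 0 (k ∸ 1 ∷ k ∸ 2 ∷ k ∸ 3 ∷ []) G → n ≤ 12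
mainTheorem6 n _ G refl ((degree≡4 , a≡0 , c∈cs) , ((u , w , u≢w , u≁w , common≡3) ∷ _) , _) =
  Configuration.n≤12 G degree≡4
    (no-common-neighbour⇒triangle-free G a≡0)
    (positive-common-neighbours⇒diameter≤2 G 0∉cs c∈cs)
    u≢w (not-¬ u≁w) common≡3
  where
  0∉cs : ¬ 0 ∈ (3 ∷ 2 ∷ 1 ∷ [])
  0∉cs (there (there (there ())))
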